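{- Let $n\ge1$, $k\ge0$ be integers with $\gcd(n,k)=1$, let $C_n$ be the cycle graph with vertices $v_1,\dots,v_n$ in cyclic order, $q=v_n$, $j\in\{1,\dots,n\}$ and $D_j=v_j-q$. For an effective divisor $E\in\mathbb{N}^n$ of degree $k$ let $N_E=[bw^{E(v_1)}bw^{E(v_2)}\cdots bw^{E(v_n)}]\in\mathcal{N}(n,k)$. Then the map $\psi:|D_j+kq|\to\mathcal{N}(n,k)$, $E\mapsto N_E$, is a bijection.
   Context: Divisors on $C_n$ are vectors in $\mathbb{Z}^n$ indexed by the vertices; $\deg E=\sum_iE(v_i)$; $L$ is the Laplacian matrix of $C_n$; $D\sim D'$ iff $D-D'\in\operatorname{im}_\mathbb{Z}L$; $|D|=\{E\in\mathbb{Z}^n:E\ge0,E\sim D\}$. A binary necklace is an equivalence class of words in the letters $b$ (black), $w$ (white) modulo cyclic shifts; $\mathcal{N}(n,k)$ is the set of binary necklaces with $n$ black and $k$ white beads; $[u]$ denotes the necklace of the word $u$, and $w^a$ denotes $a$ consecutive white beads. -}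

module Defs where

open import Data.Nat as ℕ using (ℕ; zero; suc)
open import Data.Nat.DivMod using (_%_; m%n<n)
open import Data.Integer as ℤ using (ℤ; +_)
open import Data.Fin as Fin using (Fin; toℕ; fromℕ; fromℕ<)
open import Data.List using (List; []; _∷_; _++_; replicate; drop; take; concatMap)
open import Data.List using (allFin) public
open import Data.Product using (Σ; ∃; _×_)
open import Relation.Binary.PropositionalEquality using (_≡_)
open import Relation.Nullary using (Dec; yes; no)

-- Divisors on C_n (n = suc m): vectors Z^n indexed by the vertices.
-- Vertex v_i (1 ≤ i ≤ n) is represented by the index i-1 : Fin n.
Divisor : ℕ → Set
Divisor n = Fin n → ℤ

next : ∀ {m} → Fin (suc m) → Fin (suc m)
next {m} i = fromℕ< (m%n<n (suc (toℕ i)) (suc m))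

prev : ∀ {m} → Fin (suc m) → Fin (suc m)
prev {m} i = fromℕ< (m%n<n (toℕ i ℕ.+ m) (suc m))

-- Laplacian of the cycle graph C_{suc m} (as a multigraph: for n = 2 the
-- double edge, for n = 1 a loop, giving L = 0):  (L x)_i = 2 x_i - x_{i-1} - x_{i+1}
lap : ∀ {m} → Divisor (suc m) → Divisor (suc m)
lap x i = ((+ 2) ℤ.* x i ℤ.- x (prev i)) ℤ.- x (next i)

_∼_ : ∀ {m} → Divisor (suc m) → Divisor (suc m) → Set
_∼_ {m} D D' = Σ (Divisor (suc m)) λ x → ∀ i → D i ℤ.- D' i ≡ lap x i

EffDiv : ℕ → Set
EffDiv n = Fin n → ℕ

toDiv : ∀ {n} → EffDiv n → Divisor n
toDiv E i = + (E i)

δ : ∀ {n} → Fin n → Divisor n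
δ v i with Fin._≟_ v i
... | yes _ = + 1
... | no  _ = + 0

qv : ∀ {m} → Fin (suc m)
qv {m} = fromℕ m

Djkq : ∀ {m} → Fin (suc m) → ℕ → Divisor (suc m)
Djkq j k i = (δ j i ℤ.- δ qv i) ℤ.+ (+ k) ℤ.* δ qv i

InLinSys : ∀ {m} → Divisor (suc m) → EffDiv (suc m) → Set
InLinSys D E = toDiv E ∼ D

data Bead : Set where
  b w : Bead

count : Bead → List Bead → ℕ
count c [] = 0
count b (b ∷ u) = suc (count b u)
count b (w ∷ u) = count b u
count w (b ∷ u) = count w u
count w (w ∷ u) = suc (count w u)

-- cyclic shift equivalence of words (necklace equality): u' is a rotation of u
_≈ᶜ_ : List Bead → List Bead → Set
u ≈ᶜ u' = ∃ λ r → u' ≡ drop r u ++ take r u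

-- representatives of N(n,k): words with n black and k white beads
IsNecklaceWord : ℕ → ℕ → List Bead → Set
IsNecklaceWord n k u = (count b u ≡ n) × (count w u ≡ k)

wordOf : ∀ {n} → EffDiv n → List Bead
wordOf {n} E = concatMap (λ i → b ∷ replicate (E i) w) (allFin n)

-- Linear equivalence on Cₙ is detected by the degree and by the moment Σ i·D(vᵢ₊₁) mod n:
-- the Laplacian is (1 − S)(1 − S⁻¹) for the rotation S, and its image consists exactly of
-- the divisors of degree 0 whose moment is divisible by n. For effective E the moment is
-- read off N_E as the number of (black, white) pairs minus k. Rotating a word so that b(P)
-- black beads move to the back changes that number by n·w(P) − k·b(P) ≡ −k·b(P) mod n; as k
-- is invertible mod n, exactly one of the n rotations starting with a black bead lies in the
-- class of D_j + kq.
module Submission where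

open import Defs
open import Data.Nat using (ℕ; suc)
open import Data.Nat.GCD using (gcd)
open import Data.Fin using (Fin)
open import Data.List using (List)
open import Data.Product using (Σ; _×_)
open import Relation.Binary.PropositionalEquality using (_≡_)

open import Data.Nat as ℕ using (zero; _<_; _≤_)
import Data.Nat.Properties as ℕP
open import Data.Nat.DivMod using (n%n≡0; [m+n]%n≡m%n; m≤n⇒m%n≡m)
import Data.Nat.Divisibility as ℕ∣
open import Data.Nat.GCD using (module Bézout)
open import Data.Nat.Coprimality using (Coprime; gcd≡1⇒coprime; coprime-divisor; coprime-Bézout)
open import Data.Nat.ListAction using (sum)
import Data.Nat.Tactic.RingSolver as ℕ-Ring
open import Data.Integer as ℤ using (ℤ; +_; _+_; _-_; _*_; -_)
import Data.Integer.Properties as ℤP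
open import Data.Integer.DivMod using (n%d<d; a≡a%n+[a/n]*n)
open import Data.Integer.Divisibility.Signed
  using (_∣_; divides; ∣⇒∣ᵤ; ∣m∣n⇒∣m-n; ∣m+n∣m⇒∣n)
open import Data.Integer.Tactic.RingSolver using (solve-∀)
open import Data.Fin using (zero; suc; toℕ; fromℕ; inject₁)
import Data.Fin.Properties as FP
open import Data.List
  using ([]; _∷_; _++_; length; tabulate; _∷ʳ_; replicate; concat; concatMap; map; take; drop; lookup)
import Data.List.Properties as LP
open import Data.Product using (∃; ∃₂; _,_; proj₁; proj₂; map₁; uncurry)
open import Data.Sum using (_⊎_; inj₁; inj₂)
open import Function using (_∘_; id)
open import Relation.Binary.PropositionalEquality
  using (refl; sym; trans; cong; cong₂; subst; subst₂; module ≡-Reasoning)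
open import Relation.Nullary using (yes; no)

total : List ℤ → ℤ
total []       = + 0
total (a ∷ as) = a + total as

-- moment [a₀, …, aₙ₋₁] = Σ i·aᵢ
moment : List ℤ → ℤ
moment []       = + 0
moment (a ∷ as) = moment as + total as

total-++ : ∀ xs ys → total (xs ++ ys) ≡ total xs + total ys
total-++ []       ys = sym (ℤP.+-identityˡ _)
total-++ (a ∷ xs) ys = trans (cong (λ t → a + t) (total-++ xs ys)) (sym (ℤP.+-assoc a _ _))

moment-++ : ∀ xs ys → moment (xs ++ ys) ≡ moment xs + + length xs * total ys + moment ys
moment-++ []       ys = rearrange (total ys) (moment ys)
  where
  rearrange : ∀ t m → m ≡ + 0 + + 0 * t + m
  rearrange = solve-∀
moment-++ (a ∷ xs) ys =
  trans (cong₂ _+_ (moment-++ xs ys) (total-++ xs ys))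
        (rearrange (moment xs) (total xs) (+ length xs) (total ys) (moment ys))
  where
  rearrange : ∀ mx tx l t my → mx + l * t + my + (tx + t) ≡ mx + tx + (+ 1 + l) * t + my
  rearrange = solve-∀

deg : ∀ {n} → Divisor n → ℤ
deg D = total (tabulate D)

mom : ∀ {n} → Divisor n → ℤ
mom D = moment (tabulate D)

deg-cong : ∀ {n} {f g : Divisor n} → (∀ i → f i ≡ g i) → deg f ≡ deg g
deg-cong f≗g = cong total (LP.tabulate-cong f≗g)

mom-cong : ∀ {n} {f g : Divisor n} → (∀ i → f i ≡ g i) → mom f ≡ mom g
mom-cong f≗g = cong moment (LP.tabulate-cong f≗g)

private
  sub-+-sub : ∀ a b c d → (a - b) + (c - d) ≡ (a + c) - (b + d)
  sub-+-sub = solve-∀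

deg-+ : ∀ {n} (f g : Divisor n) → deg (λ i → f i + g i) ≡ deg f + deg g
deg-+ {zero}  f g = refl
deg-+ {suc n} f g =
  trans (cong (λ t → f zero + g zero + t) (deg-+ (f ∘ suc) (g ∘ suc)))
        (interchange (f zero) (g zero) (deg (f ∘ suc)) (deg (g ∘ suc)))
  where
  interchange : ∀ a b c d → (a + b) + (c + d) ≡ (a + c) + (b + d)
  interchange = solve-∀

deg-sub : ∀ {n} (f g : Divisor n) → deg (λ i → f i - g i) ≡ deg f - deg g
deg-sub {zero}  f g = refl
deg-sub {suc n} f g =
  trans (cong (λ t → f zero - g zero + t) (deg-sub (f ∘ suc) (g ∘ suc)))
        (sub-+-sub (f zero) (g zero) (deg (f ∘ suc)) (deg (g ∘ suc)))

deg-scale : ∀ {n} (c : ℤ) (f : Divisor n) → deg (λ i → c * f i) ≡ c * deg f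
deg-scale {zero}  c f = sym (ℤP.*-zeroʳ c)
deg-scale {suc n} c f =
  trans (cong (λ t → c * f zero + t) (deg-scale c (f ∘ suc))) (sym (ℤP.*-distribˡ-+ c _ _))

deg-const : ∀ n (c : ℤ) → deg {n} (λ _ → c) ≡ + n * c
deg-const zero    c = sym (ℤP.*-zeroˡ c)
deg-const (suc n) c = trans (cong (λ t → c + t) (deg-const n c)) (sym (ℤP.suc-* (+ n) c))

mom-sub : ∀ {n} (f g : Divisor n) → mom (λ i → f i - g i) ≡ mom f - mom g
mom-sub {zero}  f g = refl
mom-sub {suc n} f g =
  trans (cong₂ _+_ (mom-sub (f ∘ suc) (g ∘ suc)) (deg-sub (f ∘ suc) (g ∘ suc)))
        (sub-+-sub (mom (f ∘ suc)) (mom (g ∘ suc)) (deg (f ∘ suc)) (deg (g ∘ suc)))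

mom-scale : ∀ {n} (c : ℤ) (f : Divisor n) → mom (λ i → c * f i) ≡ c * mom f
mom-scale {zero}  c f = sym (ℤP.*-zeroʳ c)
mom-scale {suc n} c f =
  trans (cong₂ _+_ (mom-scale c (f ∘ suc)) (deg-scale c (f ∘ suc))) (sym (ℤP.*-distribˡ-+ c _ _))

toℕ-next : ∀ {m} (i : Fin (suc m)) → toℕ (next i) ≡ suc (toℕ i) ℕ.% suc m
toℕ-next i = FP.toℕ-fromℕ< _

toℕ-prev : ∀ {m} (i : Fin (suc m)) → toℕ (prev i) ≡ (toℕ i ℕ.+ m) ℕ.% suc m
toℕ-prev i = FP.toℕ-fromℕ< _

next-inject₁ : ∀ {m} (j : Fin m) → next (inject₁ j) ≡ suc j
next-inject₁ {m} j = FP.toℕ-injective (begin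
  toℕ (next (inject₁ j))             ≡⟨ toℕ-next (inject₁ j) ⟩
  suc (toℕ (inject₁ j)) ℕ.% suc m    ≡⟨ cong (λ t → suc t ℕ.% suc m) (FP.toℕ-inject₁ j) ⟩
  suc (toℕ j) ℕ.% suc m              ≡⟨ m≤n⇒m%n≡m (FP.toℕ<n j) ⟩
  suc (toℕ j)                        ∎)
  where open ≡-Reasoning

next-last : ∀ m → next (fromℕ m) ≡ zero
next-last m = FP.toℕ-injective (begin
  toℕ (next (fromℕ m))               ≡⟨ toℕ-next (fromℕ m) ⟩
  suc (toℕ (fromℕ m)) ℕ.% suc m      ≡⟨ cong (λ t → suc t ℕ.% suc m) (FP.toℕ-fromℕ m) ⟩
  suc m ℕ.% suc m                    ≡⟨ n%n≡0 (suc m) ⟩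
  0                                  ∎)
  where open ≡-Reasoning

prev-zero : ∀ m → prev {m} zero ≡ fromℕ m
prev-zero m = FP.toℕ-injective (begin
  toℕ (prev {m} zero)  ≡⟨ toℕ-prev {m} zero ⟩
  m ℕ.% suc m          ≡⟨ m≤n⇒m%n≡m ℕP.≤-refl ⟩
  m                    ≡⟨ FP.toℕ-fromℕ m ⟨
  toℕ (fromℕ m)        ∎)
  where open ≡-Reasoning

prev-suc : ∀ {m} (j : Fin m) → prev (suc j) ≡ inject₁ j
prev-suc {m} j = FP.toℕ-injective (begin
  toℕ (prev (suc j))              ≡⟨ toℕ-prev (suc j) ⟩
  (suc (toℕ j) ℕ.+ m) ℕ.% suc m   ≡⟨ cong (ℕ._% suc m) (ℕP.+-suc (toℕ j) m) ⟨
  (toℕ j ℕ.+ suc m) ℕ.% suc m     ≡⟨ [m+n]%n≡m%n (toℕ j) (suc m) ⟩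
  toℕ j ℕ.% suc m                 ≡⟨ m≤n⇒m%n≡m (ℕP.<⇒≤ (FP.toℕ<n j)) ⟩
  toℕ j                           ≡⟨ FP.toℕ-inject₁ j ⟨
  toℕ (inject₁ j)                 ∎)
  where open ≡-Reasoning

data InitOrLast {m : ℕ} : Fin (suc m) → Set where
  init : (j : Fin m) → InitOrLast (inject₁ j)
  last : InitOrLast (fromℕ m)

initOrLast : ∀ {m} (i : Fin (suc m)) → InitOrLast i
initOrLast {zero}  zero    = last
initOrLast {suc m} zero    = init zero
initOrLast {suc m} (suc i) with initOrLast i
... | init j = init (suc j)
... | last   = last

prev-next : ∀ {m} (i : Fin (suc m)) → prev (next i) ≡ i
prev-next i with initOrLast i
... | init j = trans (cong prev (next-inject₁ j)) (prev-suc j)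
... | last   = trans (cong prev (next-last _)) (prev-zero _)

next-prev : ∀ {m} (i : Fin (suc m)) → next (prev i) ≡ i
next-prev {m} zero = trans (cong next (prev-zero m)) (next-last m)
next-prev (suc j)  = trans (cong next (prev-suc j)) (next-inject₁ j)

tabulate-∷ʳ : ∀ {A : Set} {m} (g : Fin (suc m) → A) →
              tabulate g ≡ tabulate (g ∘ inject₁) ∷ʳ g (fromℕ m)
tabulate-∷ʳ {m = zero}  g = refl
tabulate-∷ʳ {m = suc m} g = cong (g zero ∷_) (tabulate-∷ʳ (g ∘ suc))

tabulate-next : ∀ {m} (x : Divisor (suc m)) → tabulate (x ∘ next) ≡ tabulate (x ∘ suc) ∷ʳ x zero
tabulate-next {m} x = trans (tabulate-∷ʳ (x ∘ next))
  (cong₂ _∷ʳ_ (LP.tabulate-cong (cong x ∘ next-inject₁)) (cong x (next-last m)))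

deg-next : ∀ {m} (x : Divisor (suc m)) → deg (x ∘ next) ≡ deg x
deg-next x = trans (cong total (tabulate-next x))
  (trans (total-++ (tabulate (x ∘ suc)) (x zero ∷ [])) (rotate (deg (x ∘ suc)) (x zero)))
  where
  rotate : ∀ t a → t + (a + + 0) ≡ a + t
  rotate = solve-∀

deg-prev : ∀ {m} (x : Divisor (suc m)) → deg (x ∘ prev) ≡ deg x
deg-prev x = trans (sym (deg-next (x ∘ prev))) (deg-cong (cong x ∘ prev-next))

mom-next : ∀ {m} (x : Divisor (suc m)) → mom (x ∘ next) ≡ mom x + + suc m * x zero - deg x
mom-next {m} x = begin
  mom (x ∘ next)                                  ≡⟨ cong moment (tabulate-next x) ⟩
  moment (xs ++ x zero ∷ [])                      ≡⟨ moment-++ xs (x zero ∷ []) ⟩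
  moment xs + + length xs * (x zero + + 0) + (+ 0 + + 0)
                          ≡⟨ cong (λ l → moment xs + + l * (x zero + + 0) + (+ 0 + + 0))
                                  (LP.length-tabulate (x ∘ suc)) ⟩
  moment xs + + m * (x zero + + 0) + (+ 0 + + 0)  ≡⟨ rearrange (moment xs) (total xs) (+ m) (x zero) ⟩
  mom x + + suc m * x zero - deg x                ∎
  where
  open ≡-Reasoning
  xs = tabulate (x ∘ suc)
  rearrange : ∀ mx tx m a →
              mx + m * (a + + 0) + (+ 0 + + 0) ≡ mx + tx + (+ 1 + m) * a - (a + tx)
  rearrange = solve-∀

lap-linear : ∀ {m} (φ : Divisor (suc m) → ℤ) →
             (∀ f g → φ (λ i → f i - g i) ≡ φ f - φ g) →
             (∀ c f → φ (λ i → c * f i) ≡ c * φ f) →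
             ∀ x → φ (lap x) ≡ + 2 * φ x - φ (x ∘ prev) - φ (x ∘ next)
lap-linear φ φ-sub φ-scale x = begin
  φ (lap x)                                          ≡⟨ φ-sub (λ i → + 2 * x i - x (prev i)) (x ∘ next) ⟩
  φ (λ i → + 2 * x i - x (prev i)) - φ (x ∘ next)    ≡⟨ cong (λ t → t - φ (x ∘ next))
                                                              (φ-sub (λ i → + 2 * x i) (x ∘ prev)) ⟩
  φ (λ i → + 2 * x i) - φ (x ∘ prev) - φ (x ∘ next)  ≡⟨ cong (λ t → t - φ (x ∘ prev) - φ (x ∘ next))
                                                              (φ-scale (+ 2) x) ⟩
  + 2 * φ x - φ (x ∘ prev) - φ (x ∘ next)            ∎
  where open ≡-Reasoning

deg-lap : ∀ {m} (x : Divisor (suc m)) → deg (lap x) ≡ + 0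
deg-lap x = begin
  deg (lap x)                                   ≡⟨ lap-linear deg deg-sub deg-scale x ⟩
  + 2 * deg x - deg (x ∘ prev) - deg (x ∘ next) ≡⟨ cong₂ (λ p q → + 2 * deg x - p - q)
                                                         (deg-prev x) (deg-next x) ⟩
  + 2 * deg x - deg x - deg x                   ≡⟨ cancel (deg x) ⟩
  + 0                                           ∎
  where
  open ≡-Reasoning
  cancel : ∀ d → + 2 * d - d - d ≡ + 0
  cancel = solve-∀

mom-lap : ∀ {m} (x : Divisor (suc m)) → mom (lap x) ≡ (x (prev zero) - x zero) * + suc m
mom-lap {m} x = begin
  mom (lap x)                                ≡⟨ lap-linear mom mom-sub mom-scale x ⟩
  + 2 * M - Mₚ - mom (x ∘ next)              ≡⟨ cong (λ t → + 2 * M - Mₚ - t) (mom-next x) ⟩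
  + 2 * M - Mₚ - (M + n * x₀ - d)            ≡⟨ cong (λ t → + 2 * t - Mₚ - (t + n * x₀ - d)) M≡ ⟩
  + 2 * (Mₚ + n * xₗ - d) - Mₚ - (Mₚ + n * xₗ - d + n * x₀ - d)
                                             ≡⟨ rearrange Mₚ n xₗ x₀ d ⟩
  (xₗ - x₀) * n                              ∎
  where
  open ≡-Reasoning
  n = + suc m
  x₀ = x zero
  xₗ = x (prev zero)
  d = deg x
  M = mom x
  Mₚ = mom (x ∘ prev)
  M≡ : M ≡ Mₚ + n * xₗ - d
  M≡ = begin
    M                                  ≡⟨ mom-cong (cong x ∘ sym ∘ prev-next) ⟩
    mom (x ∘ prev ∘ next)              ≡⟨ mom-next (x ∘ prev) ⟩
    Mₚ + n * xₗ - deg (x ∘ prev)       ≡⟨ cong (λ t → Mₚ + n * xₗ - t) (deg-prev x) ⟩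
    Mₚ + n * xₗ - d                    ∎
  rearrange : ∀ p n l a d →
              + 2 * (p + n * l - d) - p - (p + n * l - d + n * a - d) ≡ (l - a) * n
  rearrange = solve-∀

suffixSum : ∀ {m} → Divisor (suc m) → Divisor (suc m)
suffixSum         f zero    = deg f
suffixSum {suc m} f (suc i) = suffixSum (f ∘ suc) i

suffixSum-inject₁ : ∀ {m} (f : Divisor (suc m)) (j : Fin m) →
                    suffixSum f (inject₁ j) ≡ f (inject₁ j) + suffixSum f (suc j)
suffixSum-inject₁ f zero    = refl
suffixSum-inject₁ f (suc j) = suffixSum-inject₁ (f ∘ suc) j

suffixSum-last : ∀ {m} (f : Divisor (suc m)) → suffixSum f (fromℕ m) ≡ f (fromℕ m)
suffixSum-last {zero}  f = ℤP.+-identityʳ (f zero)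
suffixSum-last {suc m} f = suffixSum-last (f ∘ suc)

deg-suffixSum : ∀ {m} (f : Divisor (suc m)) → deg (suffixSum f) ≡ deg f + mom f
deg-suffixSum {zero}  f = pad (f zero)
  where
  pad : ∀ a → a + + 0 + + 0 ≡ a + + 0 + (+ 0 + + 0)
  pad = solve-∀
deg-suffixSum {suc m} f = cong (λ t → deg f + t)
  (trans (deg-suffixSum (f ∘ suc)) (ℤP.+-comm (deg (f ∘ suc)) (mom (f ∘ suc))))

suffixSum-difference : ∀ {m} (f : Divisor (suc m)) → deg f ≡ + 0 →
                       ∀ i → f i ≡ suffixSum f i - suffixSum f (next i)
suffixSum-difference f deg≡0 i with initOrLast i
... | init j = begin
  f (inject₁ j)                                             ≡⟨ cancel (f (inject₁ j)) (suffixSum f (suc j)) ⟩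
  f (inject₁ j) + suffixSum f (suc j) - suffixSum f (suc j) ≡⟨ cong₂ _-_ (suffixSum-inject₁ f j)
                                                                       (cong (suffixSum f) (next-inject₁ j)) ⟨
  suffixSum f (inject₁ j) - suffixSum f (next (inject₁ j))  ∎
  where
  open ≡-Reasoning
  cancel : ∀ a s → a ≡ a + s - s
  cancel = solve-∀
... | last = begin
  f (fromℕ _)                                          ≡⟨ ℤP.+-identityʳ (f (fromℕ _)) ⟨
  f (fromℕ _) - + 0                                    ≡⟨ cong₂ _-_ (suffixSum-last f)
                                                          (trans (cong (suffixSum f) (next-last _)) deg≡0) ⟨
  suffixSum f (fromℕ _) - suffixSum f (next (fromℕ _)) ∎
  where open ≡-Reasoning

-- lap = (1 − S)(1 − S⁻¹) for the rotation S x = x ∘ next. Both difference operators are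
-- inverted by suffix sums on degree-0 divisors; the constant of integration in between can
-- be chosen to give degree 0 exactly because n ∣ mom Δ.
lap-surjective : ∀ {m} (Δ : Divisor (suc m)) → deg Δ ≡ + 0 → + suc m ∣ mom Δ →
                 ∃ λ x → ∀ i → Δ i ≡ lap x i
lap-surjective {m} Δ deg≡0 (divides c mom≡) = x , Δ≡lap
  where
  open ≡-Reasoning
  n = + suc m
  u = suffixSum Δ
  z : Divisor (suc m)
  z i = u i - c
  deg-z : deg z ≡ + 0
  deg-z = begin
    deg z                         ≡⟨ deg-sub u (λ _ → c) ⟩
    deg u - deg {suc m} (λ _ → c) ≡⟨ cong₂ _-_ (deg-suffixSum Δ) (deg-const (suc m) c) ⟩
    deg Δ + mom Δ - n * c         ≡⟨ cong₂ (λ d t → d + t - n * c) deg≡0 mom≡ ⟩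
    + 0 + c * n - n * c           ≡⟨ cancel c n ⟩
    + 0                           ∎
    where
    cancel : ∀ c n → + 0 + c * n - n * c ≡ + 0
    cancel = solve-∀
  v = suffixSum z
  x : Divisor (suc m)
  x i = - v (next i)
  z≡x-diff : ∀ i → z i ≡ x i - x (prev i)
  z≡x-diff i = begin
    z i                            ≡⟨ suffixSum-difference z deg-z i ⟩
    v i - v (next i)               ≡⟨ cong (λ j → v j - v (next i)) (next-prev i) ⟨
    v (next (prev i)) - v (next i) ≡⟨ flip (v (next (prev i))) (v (next i)) ⟩
    x i - x (prev i)               ∎
    where
    flip : ∀ a b → a - b ≡ - b - - a
    flip = solve-∀
  Δ≡lap : ∀ i → Δ i ≡ lap x i
  Δ≡lap i = begin
    Δ i                            ≡⟨ suffixSum-difference Δ deg≡0 i ⟩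
    u i - u (next i)               ≡⟨ shift (u i) (u (next i)) c ⟩
    z i - z (next i)               ≡⟨ cong₂ _-_ (z≡x-diff i) (z≡x-diff (next i)) ⟩
    x i - x (prev i) - (x (next i) - x (prev (next i)))
                                   ≡⟨ cong (λ j → x i - x (prev i) - (x (next i) - x j)) (prev-next i) ⟩
    x i - x (prev i) - (x (next i) - x i)
                                   ≡⟨ collect (x i) (x (prev i)) (x (next i)) ⟩
    lap x i                        ∎
    where
    shift : ∀ a b c → a - b ≡ (a - c) - (b - c)
    shift = solve-∀
    collect : ∀ a p q → a - p - (q - a) ≡ + 2 * a - p - q
    collect = solve-∀

∼-invariants : ∀ {m} (D D' : Divisor (suc m)) → D ∼ D' →
               deg D ≡ deg D' × + suc m ∣ mom D - mom D'
∼-invariants D D' (x , D-D'≡lap) =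
  ℤP.i-j≡0⇒i≡j _ _ (trans (sym (deg-sub D D')) (trans (deg-cong D-D'≡lap) (deg-lap x))) ,
  divides (x (prev zero) - x zero) (trans (sym (mom-sub D D')) (trans (mom-cong D-D'≡lap) (mom-lap x)))

invariants-∼ : ∀ {m} (D D' : Divisor (suc m)) →
               deg D ≡ deg D' → + suc m ∣ mom D - mom D' → D ∼ D'
invariants-∼ {m} D D' deg≡ n∣ = lap-surjective (λ i → D i - D' i)
  (trans (deg-sub D D') (ℤP.i≡j⇒i-j≡0 deg≡)) (subst (+ suc m ∣_) (sym (mom-sub D D')) n∣)

δ-suc : ∀ {n} (v i : Fin n) → δ (suc v) (suc i) ≡ δ v i
δ-suc v i with v FP.≟ i
... | yes _ = refl
... | no  _ = refl

deg-δ : ∀ {n} (v : Fin n) → deg (δ v) ≡ + 1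
deg-δ {suc n} zero    = cong (λ t → + 1 + t) (trans (deg-const n (+ 0)) (ℤP.*-zeroʳ (+ n)))
deg-δ {suc n} (suc v) = trans (ℤP.+-identityˡ _) (trans (deg-cong (δ-suc v)) (deg-δ v))

deg-Djkq : ∀ {m} (j : Fin (suc m)) k → deg (Djkq j k) ≡ + k
deg-Djkq {m} j k = begin
  deg (Djkq j k)                                      ≡⟨ deg-+ (λ i → δ j i - δ q i) (λ i → + k * δ q i) ⟩
  deg (λ i → δ j i - δ q i) + deg (λ i → + k * δ q i) ≡⟨ cong₂ _+_ (deg-sub (δ j) (δ q))
                                                                (deg-scale (+ k) (δ q)) ⟩
  deg (δ j) - deg (δ q) + + k * deg (δ q)             ≡⟨ cong₂ (λ s t → s - t + + k * t)
                                                                (deg-δ j) (deg-δ q) ⟩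
  + 1 - + 1 + + k * + 1                               ≡⟨ cancel (+ k) ⟩
  + k                                                 ∎
  where
  open ≡-Reasoning
  q : Fin (suc m)
  q = qv
  cancel : ∀ k → + 1 - + 1 + k * + 1 ≡ k
  cancel = solve-∀

count-++ : ∀ c u v → count c (u ++ v) ≡ count c u ℕ.+ count c v
count-++ c [] v = refl
count-++ b (b ∷ u) v = cong suc (count-++ b u v)
count-++ b (w ∷ u) v = count-++ b u v
count-++ w (b ∷ u) v = count-++ w u v
count-++ w (w ∷ u) v = cong suc (count-++ w u v)

count-rotate : ∀ c u v → count c (v ++ u) ≡ count c (u ++ v)
count-rotate c u v = trans (count-++ c v u)
  (trans (ℕP.+-comm (count c v) (count c u)) (sym (count-++ c u v)))

bwPairs : List Bead → ℕ
bwPairs []      = 0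
bwPairs (b ∷ u) = count w u ℕ.+ bwPairs u
bwPairs (w ∷ u) = bwPairs u

bwPairs-++ : ∀ u v → bwPairs (u ++ v) ≡ bwPairs u ℕ.+ count b u ℕ.* count w v ℕ.+ bwPairs v
bwPairs-++ []      v = refl
bwPairs-++ (w ∷ u) v = bwPairs-++ u v
bwPairs-++ (b ∷ u) v rewrite count-++ w u v | bwPairs-++ u v =
  rearrange (count w u) (count w v) (bwPairs u) (count b u) (bwPairs v)
  where
  rearrange : ∀ cu cv pu bu pv → cu ℕ.+ cv ℕ.+ (pu ℕ.+ bu ℕ.* cv ℕ.+ pv)
                                 ≡ cu ℕ.+ pu ℕ.+ (1 ℕ.+ bu) ℕ.* cv ℕ.+ pv
  rearrange = ℕ-Ring.solve-∀

-- Moving P to the end changes bwPairs by n·w(P) − k·b(P), where n and k count the black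
-- and white beads; stated with both sides moved so that no subtraction occurs in ℕ.
bwPairs-rotate : ∀ P Q → bwPairs (Q ++ P) ℕ.+ count b P ℕ.* count w (P ++ Q)
                       ≡ bwPairs (P ++ Q) ℕ.+ count w P ℕ.* count b (P ++ Q)
bwPairs-rotate P Q rewrite bwPairs-++ Q P | bwPairs-++ P Q | count-++ w P Q | count-++ b P Q =
  rearrange (bwPairs P) (bwPairs Q) (count b P) (count b Q) (count w P) (count w Q)
  where
  rearrange : ∀ pP pQ bP bQ wP wQ → pQ ℕ.+ bQ ℕ.* wP ℕ.+ pP ℕ.+ bP ℕ.* (wP ℕ.+ wQ)
                                    ≡ pP ℕ.+ bP ℕ.* wQ ℕ.+ pQ ℕ.+ wP ℕ.* (bP ℕ.+ bQ)
  rearrange = ℕ-Ring.solve-∀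

block : ℕ → List Bead
block a = b ∷ replicate a w

blocks : List ℕ → List Bead
blocks = concatMap block

wordOf-blocks : ∀ {n} (E : EffDiv n) → wordOf E ≡ blocks (tabulate E)
wordOf-blocks E =
  cong concat (trans (LP.map-tabulate id (block ∘ E)) (sym (LP.map-tabulate E block)))

count-b-whites : ∀ a u → count b (replicate a w ++ u) ≡ count b u
count-b-whites zero    u = refl
count-b-whites (suc a) u = count-b-whites a u

count-w-whites : ∀ a u → count w (replicate a w ++ u) ≡ a ℕ.+ count w u
count-w-whites zero    u = refl
count-w-whites (suc a) u = cong suc (count-w-whites a u)

bwPairs-whites : ∀ a u → bwPairs (replicate a w ++ u) ≡ bwPairs u
bwPairs-whites zero    u = refl
bwPairs-whites (suc a) u = bwPairs-whites a u

count-b-blocks : ∀ xs → count b (blocks xs) ≡ length xs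
count-b-blocks []       = refl
count-b-blocks (x ∷ xs) = cong suc (trans (count-b-whites x (blocks xs)) (count-b-blocks xs))

count-w-blocks : ∀ xs → count w (blocks xs) ≡ sum xs
count-w-blocks []       = refl
count-w-blocks (x ∷ xs) = trans (count-w-whites x (blocks xs)) (cong (x ℕ.+_) (count-w-blocks xs))

total-map-+ : ∀ xs → total (map +_ xs) ≡ + sum xs
total-map-+ []       = refl
total-map-+ (x ∷ xs) = cong (λ t → + x + t) (total-map-+ xs)

bwPairs-blocks : ∀ xs → + bwPairs (blocks xs) ≡ moment (map +_ xs) + total (map +_ xs)
bwPairs-blocks []       = refl
bwPairs-blocks (x ∷ xs) = begin
  + (count w (replicate x w ++ B) ℕ.+ bwPairs (replicate x w ++ B))
                           ≡⟨ cong +_ (cong₂ ℕ._+_ (count-w-whites x B) (bwPairs-whites x B)) ⟩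
  + (x ℕ.+ count w B ℕ.+ bwPairs B)
                           ≡⟨ ℤP.pos-+ (x ℕ.+ count w B) (bwPairs B) ⟩
  + x + + count w B + + bwPairs B
                           ≡⟨ cong₂ (λ s t → + x + s + t)
                                    (trans (cong +_ (count-w-blocks xs)) (sym (total-map-+ xs)))
                                    (bwPairs-blocks xs) ⟩
  + x + T + (M + T)        ≡⟨ rearrange (+ x) T M ⟩
  M + T + (+ x + T)        ∎
  where
  open ≡-Reasoning
  B = blocks xs
  M = moment (map +_ xs)
  T = total (map +_ xs)
  rearrange : ∀ a t m → a + t + (m + t) ≡ m + t + (a + t)
  rearrange = solve-∀

splitBlocks : List Bead → ℕ × List ℕ
splitBlocks []      = 0 , []
splitBlocks (w ∷ u) = map₁ suc (splitBlocks u)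
splitBlocks (b ∷ u) = 0 , uncurry _∷_ (splitBlocks u)

joinBlocks : ℕ × List ℕ → List Bead
joinBlocks (a , xs) = replicate a w ++ blocks xs

joinBlocks-splitBlocks : ∀ u → joinBlocks (splitBlocks u) ≡ u
joinBlocks-splitBlocks []      = refl
joinBlocks-splitBlocks (w ∷ u) = cong (w ∷_) (joinBlocks-splitBlocks u)
joinBlocks-splitBlocks (b ∷ u) = cong (b ∷_) (joinBlocks-splitBlocks u)

splitBlocks-joinBlocks : ∀ a xs → splitBlocks (joinBlocks (a , xs)) ≡ (a , xs)
splitBlocks-joinBlocks (suc a) xs       = cong (map₁ suc) (splitBlocks-joinBlocks a xs)
splitBlocks-joinBlocks zero    []       = refl
splitBlocks-joinBlocks zero    (x ∷ xs) = cong (λ p → 0 , uncurry _∷_ p) (splitBlocks-joinBlocks x xs)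

blocks-injective : ∀ {xs ys} → blocks xs ≡ blocks ys → xs ≡ ys
blocks-injective {xs} {ys} eq = cong proj₂ (begin
  (0 , xs)                   ≡⟨ splitBlocks-joinBlocks 0 xs ⟨
  splitBlocks (blocks xs)    ≡⟨ cong splitBlocks eq ⟩
  splitBlocks (blocks ys)    ≡⟨ splitBlocks-joinBlocks 0 ys ⟩
  (0 , ys)                   ∎)
  where open ≡-Reasoning

splitAtBlack : ∀ u t → t < count b u → ∃₂ λ P R → u ≡ P ++ b ∷ R × count b P ≡ t
splitAtBlack (w ∷ u) t       t<c with splitAtBlack u t t<c
... | P , R , u≡ , cP = w ∷ P , R , cong (w ∷_) u≡ , cP
splitAtBlack (b ∷ u) zero    _   = [] , u , refl , refl
splitAtBlack (b ∷ u) (suc t) t<c with splitAtBlack u t (ℕ.s<s⁻¹ t<c)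
... | P , R , u≡ , cP = b ∷ P , R , cong (b ∷_) u≡ , cong suc cP

blackFree-prefix : ∀ P {Q R} → P ++ Q ≡ b ∷ R → count b P ≡ 0 → P ≡ []
blackFree-prefix []      _  _  = refl
blackFree-prefix (b ∷ P) _  ()
blackFree-prefix (w ∷ P) () _

take-length-++ : ∀ {A : Set} (P Q : List A) → take (length P) (P ++ Q) ≡ P
take-length-++ []      Q = refl
take-length-++ (x ∷ P) Q = cong (x ∷_) (take-length-++ P Q)

drop-length-++ : ∀ {A : Set} (P Q : List A) → drop (length P) (P ++ Q) ≡ Q
drop-length-++ []      Q = refl
drop-length-++ (x ∷ P) Q = drop-length-++ P Q

++-rotation : ∀ P Q → (P ++ Q) ≈ᶜ (Q ++ P)
++-rotation P Q = length P , sym (cong₂ _++_ (drop-length-++ P Q) (take-length-++ P Q))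

tabulate-injective : ∀ {A : Set} {n} (f g : Fin n → A) →
                     tabulate f ≡ tabulate g → ∀ i → f i ≡ g i
tabulate-injective f g eq zero    = LP.∷-injectiveˡ eq
tabulate-injective f g eq (suc i) = tabulate-injective (f ∘ suc) (g ∘ suc) (LP.∷-injectiveʳ eq) i

tabulate-surjective : ∀ {A : Set} {n} (xs : List A) → length xs ≡ n →
                      ∃ λ (f : Fin n → A) → tabulate f ≡ xs
tabulate-surjective xs refl = lookup xs , LP.tabulate-lookup xs

pos-1+* : ∀ x y a c → 1 ℕ.+ x ℕ.* y ≡ a ℕ.* c → + 1 + + x * + y ≡ + a * + c
pos-1+* x y a c eq =
  trans (cong (λ t → + 1 + t) (sym (ℤP.pos-* x y))) (trans (cong +_ eq) (ℤP.pos-* a c))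

coprime-invertible : ∀ {n k} → Coprime n k → ∃ λ k′ → + n ∣ + k * k′ - + 1
coprime-invertible {n} {k} cop with coprime-Bézout cop
... | Bézout.+- x y 1+yk≡xn = - + y , divides (- + x) (begin
  + k * - + y - + 1   ≡⟨ rearrange (+ k) (+ y) ⟩
  - (+ 1 + + y * + k) ≡⟨ cong -_ (pos-1+* y k x n 1+yk≡xn) ⟩
  - (+ x * + n)       ≡⟨ ℤP.neg-distribˡ-* (+ x) (+ n) ⟩
  - + x * + n         ∎)
  where
  open ≡-Reasoning
  rearrange : ∀ k y → k * - y - + 1 ≡ - (+ 1 + y * k)
  rearrange = solve-∀
... | Bézout.-+ x y 1+xn≡yk = + y , divides (+ x) (begin
  + k * + y - + 1           ≡⟨ cong (λ t → t - + 1) (ℤP.*-comm (+ k) (+ y)) ⟩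
  + y * + k - + 1           ≡⟨ cong (λ t → t - + 1) (pos-1+* x n y k 1+xn≡yk) ⟨
  + 1 + + x * + n - + 1     ≡⟨ cancel (+ x * + n) ⟩
  + x * + n                 ∎)
  where
  open ≡-Reasoning
  cancel : ∀ a → + 1 + a - + 1 ≡ a
  cancel = solve-∀

mod-solvable : ∀ {m k} → Coprime (suc m) k → (r : ℤ) →
               ∃ λ t → t < suc m × + suc m ∣ + t * + k - r
mod-solvable {m} {k} cop r with coprime-invertible cop
... | k′ , divides e kk′-1≡en = t , n%d<d (k′ * r) n , divides (r * e - q * + k) (begin
  + t * + k - r                      ≡⟨ cong (λ s → s * + k - r) t≡ ⟩
  (k′ * r - q * n) * + k - r         ≡⟨ rearrange (+ k) k′ r q n ⟩
  r * (+ k * k′ - + 1) - q * + k * n ≡⟨ cong (λ s → r * s - q * + k * n) kk′-1≡en ⟩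
  r * (e * n) - q * + k * n          ≡⟨ collect r e q (+ k) n ⟩
  (r * e - q * + k) * n              ∎)
  where
  open ≡-Reasoning
  n = + suc m
  t = (k′ * r) ℤ.% n
  q = (k′ * r) ℤ./ n
  t≡ : + t ≡ k′ * r - q * n
  t≡ = trans (isolate (+ t) (q * n))
             (cong (λ s → s - q * n) (sym (a≡a%n+[a/n]*n (k′ * r) n)))
    where
    isolate : ∀ a b → a ≡ a + b - b
    isolate = solve-∀
  rearrange : ∀ k k′ r q n → (k′ * r - q * n) * k - r ≡ r * (k * k′ - + 1) - q * k * n
  rearrange = solve-∀
  collect : ∀ r e q k n → r * (e * n) - q * k * n ≡ (r * e - q * k) * n
  collect = solve-∀

∣-bounded : ∀ {n t} → suc n ℕ∣.∣ t → t ≤ suc n → t ≡ 0 ⊎ t ≡ suc n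
∣-bounded {t = zero}  _   _   = inj₁ refl
∣-bounded {t = suc _} n∣t t≤n = inj₂ (ℕP.≤-antisym t≤n (ℕ∣.∣⇒≤ n∣t))

tabulate-toDiv : ∀ {n} (E : EffDiv n) → tabulate (toDiv E) ≡ map +_ (tabulate E)
tabulate-toDiv E = sym (LP.map-tabulate E (+_))

count-b-wordOf : ∀ {n} (E : EffDiv n) → count b (wordOf E) ≡ n
count-b-wordOf E = trans (cong (count b) (wordOf-blocks E))
  (trans (count-b-blocks (tabulate E)) (LP.length-tabulate E))

wordOf-surjective : ∀ {n} R → count b (b ∷ R) ≡ n → ∃ λ (E : EffDiv n) → wordOf E ≡ b ∷ R
wordOf-surjective {n} R cb = E , trans (wordOf-blocks E) (trans (cong blocks tabE) R≡)
  where
  ys = uncurry _∷_ (splitBlocks R)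
  R≡ : blocks ys ≡ b ∷ R
  R≡ = cong (b ∷_) (joinBlocks-splitBlocks R)
  preimage : ∃ λ (E : EffDiv n) → tabulate E ≡ ys
  preimage = tabulate-surjective ys (trans (sym (count-b-blocks ys)) (trans (cong (count b) R≡) cb))
  E = proj₁ preimage
  tabE = proj₂ preimage

deg-toDiv : ∀ {n} (E : EffDiv n) → deg (toDiv E) ≡ + count w (wordOf E)
deg-toDiv E = begin
  deg (toDiv E)                   ≡⟨ cong total (tabulate-toDiv E) ⟩
  total (map +_ (tabulate E))     ≡⟨ total-map-+ (tabulate E) ⟩
  + sum (tabulate E)              ≡⟨ cong +_ (count-w-blocks (tabulate E)) ⟨
  + count w (blocks (tabulate E)) ≡⟨ cong (+_ ∘ count w) (wordOf-blocks E) ⟨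
  + count w (wordOf E)            ∎
  where open ≡-Reasoning

bwPairs-wordOf : ∀ {n} (E : EffDiv n) → + bwPairs (wordOf E) ≡ mom (toDiv E) + deg (toDiv E)
bwPairs-wordOf E = begin
  + bwPairs (wordOf E)                                  ≡⟨ cong (+_ ∘ bwPairs) (wordOf-blocks E) ⟩
  + bwPairs (blocks (tabulate E))                       ≡⟨ bwPairs-blocks (tabulate E) ⟩
  moment (map +_ (tabulate E)) + total (map +_ (tabulate E))
                                   ≡⟨ cong (λ xs → moment xs + total xs) (tabulate-toDiv E) ⟨
  mom (toDiv E) + deg (toDiv E)                         ∎
  where open ≡-Reasoning

-- Since bwPairs (wordOf E) = mom E + deg E, this is the condition of ∼-invariants for E ∼ D.
WordInLinSys : ∀ {m} → Divisor (suc m) → ℕ → List Bead → Set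
WordInLinSys {m} D k u = count w u ≡ k × + suc m ∣ + bwPairs u - (mom D + + k)

module _ {m k} (D : Divisor (suc m)) (deg≡k : deg D ≡ + k) (E : EffDiv (suc m)) where

  private
    shift : deg (toDiv E) ≡ + k → + bwPairs (wordOf E) - (mom D + + k) ≡ mom (toDiv E) - mom D
    shift degE≡k = begin
      + bwPairs (wordOf E) - (mom D + + k)          ≡⟨ cong (λ t → t - (mom D + + k)) (bwPairs-wordOf E) ⟩
      mom (toDiv E) + deg (toDiv E) - (mom D + + k) ≡⟨ cong (λ t → mom (toDiv E) + t - (mom D + + k))
                                                             degE≡k ⟩
      mom (toDiv E) + + k - (mom D + + k)           ≡⟨ cancel (mom (toDiv E)) (mom D) (+ k) ⟩
      mom (toDiv E) - mom D                         ∎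
      where
      open ≡-Reasoning
      cancel : ∀ a d k → a + k - (d + k) ≡ a - d
      cancel = solve-∀

  inLinSys⇒word : InLinSys D E → WordInLinSys D k (wordOf E)
  inLinSys⇒word E∼D with ∼-invariants (toDiv E) D E∼D
  ... | degE≡degD , n∣ =
    ℤP.+-injective (trans (sym (deg-toDiv E)) degE≡k) , subst (+ suc m ∣_) (sym (shift degE≡k)) n∣
    where
    degE≡k = trans degE≡degD deg≡k

  word⇒inLinSys : WordInLinSys D k (wordOf E) → InLinSys D E
  word⇒inLinSys (w≡k , n∣) =
    invariants-∼ (toDiv E) D (trans degE≡k (sym deg≡k)) (subst (+ suc m ∣_) (shift degE≡k) n∣)
    where
    degE≡k = trans (deg-toDiv E) (cong +_ w≡k)

bwPairs-rotate-mod : ∀ {n k} P Q → count b (P ++ Q) ≡ n → count w (P ++ Q) ≡ k →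
                     + n ∣ + bwPairs (Q ++ P) - + bwPairs (P ++ Q) + + count b P * + k
bwPairs-rotate-mod {n} {k} P Q cb cw = divides (+ wP) (begin
  + pv - + pu + + bP * + k      ≡⟨ regroup (+ pv) (+ pu) (+ bP * + k) ⟩
  + pv + + bP * + k - + pu      ≡⟨ cong (λ t → t - + pu) rotateℤ ⟩
  + pu + + wP * + n - + pu      ≡⟨ cancel (+ pu) (+ wP * + n) ⟩
  + wP * + n                    ∎)
  where
  open ≡-Reasoning
  pu = bwPairs (P ++ Q)
  pv = bwPairs (Q ++ P)
  bP = count b P
  wP = count w P
  rotateℕ : pv ℕ.+ bP ℕ.* k ≡ pu ℕ.+ wP ℕ.* n
  rotateℕ = subst₂ (λ c d → pv ℕ.+ bP ℕ.* c ≡ pu ℕ.+ wP ℕ.* d) cw cb (bwPairs-rotate P Q)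
  rotateℤ : + pv + + bP * + k ≡ + pu + + wP * + n
  rotateℤ = begin
    + pv + + bP * + k           ≡⟨ cong (λ t → + pv + t) (ℤP.pos-* bP k) ⟨
    + (pv ℕ.+ bP ℕ.* k)         ≡⟨ cong +_ rotateℕ ⟩
    + (pu ℕ.+ wP ℕ.* n)         ≡⟨ cong (λ t → + pu + t) (ℤP.pos-* wP n) ⟩
    + pu + + wP * + n           ∎
  regroup : ∀ a b c → a - b + c ≡ a + c - b
  regroup = solve-∀
  cancel : ∀ a b → a + b - a ≡ b
  cancel = solve-∀

rotation-trivial : ∀ P Q {R R′} → P ++ Q ≡ b ∷ R → Q ++ P ≡ b ∷ R′ →
                   count b P ≡ 0 ⊎ count b Q ≡ 0 → P ++ Q ≡ Q ++ P
rotation-trivial P Q u≡ _  (inj₁ bP≡0) rewrite blackFree-prefix P u≡ bP≡0 = sym (LP.++-identityʳ Q)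
rotation-trivial P Q _  v≡ (inj₂ bQ≡0) rewrite blackFree-prefix Q v≡ bQ≡0 = LP.++-identityʳ P

-- Rotating by P moves bwPairs by −k·b(P) mod n, so n ∣ b(P) by coprimality.
class-preserving-rotation-trivial :
  ∀ {m k} → Coprime (suc m) k → ∀ P Q {R R′} → P ++ Q ≡ b ∷ R → Q ++ P ≡ b ∷ R′ →
  count b (P ++ Q) ≡ suc m → count w (P ++ Q) ≡ k →
  + suc m ∣ + bwPairs (Q ++ P) - + bwPairs (P ++ Q) → P ++ Q ≡ Q ++ P
class-preserving-rotation-trivial {m} {k} cop P Q u≡ v≡ cb cw n∣ =
  rotation-trivial P Q u≡ v≡ (blackFree-part (∣-bounded n∣bP bP≤n))
  where
  n∣bPk : + suc m ∣ + (count b P ℕ.* k)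
  n∣bPk = subst (+ suc m ∣_) (sym (ℤP.pos-* (count b P) k))
                (∣m+n∣m⇒∣n (bwPairs-rotate-mod P Q cb cw) n∣)
  n∣bP : suc m ℕ∣.∣ count b P
  n∣bP = coprime-divisor cop (subst (suc m ℕ∣.∣_) (ℕP.*-comm (count b P) k) (∣⇒∣ᵤ n∣bPk))
  bP+bQ≡n : count b P ℕ.+ count b Q ≡ suc m
  bP+bQ≡n = trans (sym (count-++ b P Q)) cb
  bP≤n : count b P ≤ suc m
  bP≤n = subst (count b P ≤_) bP+bQ≡n (ℕP.m≤m+n (count b P) (count b Q))
  blackFree-part : count b P ≡ 0 ⊎ count b P ≡ suc m → count b P ≡ 0 ⊎ count b Q ≡ 0
  blackFree-part (inj₁ bP≡0) = inj₁ bP≡0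
  blackFree-part (inj₂ bP≡n) = inj₂ (ℕP.+-cancelˡ-≡ (suc m) _ _
    (trans (trans (cong (ℕ._+ count b Q) (sym bP≡n)) bP+bQ≡n) (sym (ℕP.+-identityʳ (suc m)))))

rotate-into-class : ∀ {n k} (c : ℤ) P Q → count b (P ++ Q) ≡ n → count w (P ++ Q) ≡ k →
                    + n ∣ + count b P * + k - (+ bwPairs (P ++ Q) - c) → + n ∣ + bwPairs (Q ++ P) - c
rotate-into-class {n} c P Q cb cw n∣ =
  subst (+ n ∣_) (cancel (+ bwPairs (Q ++ P)) (+ bwPairs (P ++ Q)) (+ count b P * _) c)
        (∣m∣n⇒∣m-n (bwPairs-rotate-mod P Q cb cw) n∣)
  where
  cancel : ∀ v u s c → v - u + s - (s - (u - c)) ≡ v - c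
  cancel = solve-∀

rotation-preimage : ∀ {m k} (D : Divisor (suc m)) → deg D ≡ + k → ∀ P R →
                    count b (P ++ b ∷ R) ≡ suc m → count w (P ++ b ∷ R) ≡ k →
                    + suc m ∣ + count b P * + k - (+ bwPairs (P ++ b ∷ R) - (mom D + + k)) →
                    ∃ λ E → InLinSys D E × wordOf E ≈ᶜ (P ++ b ∷ R)
rotation-preimage {m} {k} D deg≡k P R cb cw n∣
  with wordOf-surjective {suc m} (R ++ P) (trans (count-rotate b P (b ∷ R)) cb)
... | E , wordE≡ = E , word⇒inLinSys D deg≡k E (cwE , n∣E) , E≈u
  where
  cwE : count w (wordOf E) ≡ k
  cwE = trans (cong (count w) wordE≡) (trans (count-rotate w P (b ∷ R)) cw)
  n∣E : + suc m ∣ + bwPairs (wordOf E) - (mom D + + k)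
  n∣E = subst (λ v → + suc m ∣ + bwPairs v - (mom D + + k)) (sym wordE≡)
              (rotate-into-class (mom D + + k) P (b ∷ R) cb cw n∣)
  E≈u : wordOf E ≈ᶜ (P ++ b ∷ R)
  E≈u = subst (_≈ᶜ (P ++ b ∷ R)) (sym wordE≡) (++-rotation (b ∷ R) P)

ψ-wellDefined : ∀ {m k} (D : Divisor (suc m)) → deg D ≡ + k →
                (E : EffDiv (suc m)) → InLinSys D E → IsNecklaceWord (suc m) k (wordOf E)
ψ-wellDefined D deg≡k E E∈ = count-b-wordOf E , proj₁ (inLinSys⇒word D deg≡k E E∈)

ψ-injective : ∀ {m k} (D : Divisor (suc m)) → Coprime (suc m) k → deg D ≡ + k →
              (E E′ : EffDiv (suc m)) → InLinSys D E → InLinSys D E′ →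
              wordOf E ≈ᶜ wordOf E′ → ∀ i → E i ≡ E′ i
ψ-injective {m} {k} D cop deg≡k E E′ E∈ E′∈ (r , v≡) =
  tabulate-injective E E′ (blocks-injective (begin
  blocks (tabulate E)    ≡⟨ wordOf-blocks E ⟨
  wordOf E               ≡⟨ u≡ ⟩
  P ++ Q                 ≡⟨ class-preserving-rotation-trivial cop P Q (sym u≡) (sym v≡) cb cw n∣ ⟩
  Q ++ P                 ≡⟨ v≡ ⟨
  wordOf E′              ≡⟨ wordOf-blocks E′ ⟩
  blocks (tabulate E′)   ∎))
  where
  open ≡-Reasoning
  u = wordOf E
  P = take r u
  Q = drop r u
  u≡ : u ≡ P ++ Q
  u≡ = sym (LP.take++drop≡id r u)
  cb : count b (P ++ Q) ≡ suc m
  cb = trans (cong (count b) (sym u≡)) (count-b-wordOf E)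
  cw : count w (P ++ Q) ≡ k
  cw = trans (cong (count w) (sym u≡)) (proj₁ (inLinSys⇒word D deg≡k E E∈))
  n∣ : + suc m ∣ + bwPairs (Q ++ P) - + bwPairs (P ++ Q)
  n∣ = subst₂ (λ v u → + suc m ∣ + bwPairs v - + bwPairs u) v≡ u≡
         (subst (+ suc m ∣_) (cancel (+ bwPairs (wordOf E′)) (+ bwPairs u) (mom D + + k))
                (∣m∣n⇒∣m-n (proj₂ (inLinSys⇒word D deg≡k E′ E′∈))
                           (proj₂ (inLinSys⇒word D deg≡k E E∈))))
    where
    cancel : ∀ v u c → v - c - (u - c) ≡ v - u
    cancel = solve-∀

ψ-surjective : ∀ {m k} (D : Divisor (suc m)) → Coprime (suc m) k → deg D ≡ + k →
               (u : List Bead) → IsNecklaceWord (suc m) k u →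
               ∃ λ E → InLinSys D E × wordOf E ≈ᶜ u
ψ-surjective {m} {k} D cop deg≡k u (cb , cw) =
  let t , t<n , n∣t*k-r    = mod-solvable cop (+ bwPairs u - (mom D + + k))
      P , R , u≡ , b[P]≡t = splitAtBlack u t (subst (t <_) (sym cb) t<n)
  in subst (λ v → ∃ λ E → InLinSys D E × wordOf E ≈ᶜ v) (sym u≡)
       (rotation-preimage D deg≡k P R (trans (cong (count b) (sym u≡)) cb)
                                      (trans (cong (count w) (sym u≡)) cw)
         (subst₂ (λ s v → + suc m ∣ + s * + k - (+ bwPairs v - (mom D + + k)))
                 (sym b[P]≡t) u≡ n∣t*k-r))

theorem6p7 : (m k : ℕ) → gcd (suc m) k ≡ 1 → (j : Fin (suc m)) →
    ((E : EffDiv (suc m)) → InLinSys (Djkq j k) E → IsNecklaceWord (suc m) k (wordOf E))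
    × ((E E' : EffDiv (suc m)) → InLinSys (Djkq j k) E → InLinSys (Djkq j k) E' →
        wordOf E ≈ᶜ wordOf E' → (∀ i → E i ≡ E' i))
    × ((u : List Bead) → IsNecklaceWord (suc m) k u →
        Σ (EffDiv (suc m)) λ E → InLinSys (Djkq j k) E × (wordOf E ≈ᶜ u))
theorem6p7 m k gcd≡1 j = ψ-wellDefined D deg≡k , ψ-injective D cop deg≡k , ψ-surjective D cop deg≡k
  where
  D = Djkq j k
  cop = gcd≡1⇒coprime gcd≡1
  deg≡k = deg-Djkq j k
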